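{- Let $n\geq 3$ be odd, $m\geq 2$, and let $\Gamma$ be an Abelian group of order $2mn$ having a cyclic subgroup of order $2m$. Then the generalized closed web $CW_{m,n}$ is $\Gamma$-harmonious.
   Context: The generalized prism $Y_{m,n}$ is the Cartesian product $P_m\Box C_n$ (layers $C^1,\dots,C^m$ of $C_n$ with corresponding vertices of consecutive layers adjacent). The generalized closed web $CW_{m,n}$ is obtained from $Y_{m,n}$ by adding one new vertex joined to every vertex of the top cycle $C^1$; it has $2mn$ edges. For a graph $G=(V,E)$ with $q$ edges and a finite Abelian group $\Gamma$ of order $q$, $G$ is $\Gamma$-harmonious if there is an injection $f:V\to\Gamma$ such that the induced edge labeling $w(xy)=f(x)+f(y)$ is a bijection from $E$ to $\Gamma$. -}

module Defs where

open import Level using (Level; _⊔_)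
open import Data.Nat using (ℕ; zero; suc; _+_; _*_; _<_; _%_; NonZero)
open import Data.Nat.DivMod using (m%n<n)
open import Data.Fin using (Fin; toℕ; fromℕ<)
open import Data.Product using (Σ; ∃; _×_; _,_)
open import Relation.Nullary using (¬_)
open import Relation.Binary.PropositionalEquality using (_≡_)
open import Algebra.Bundles using (AbelianGroup)

next : ∀ {n} → Fin n → Fin n
next {suc k} j = fromℕ< (m%n<n (suc (toℕ j)) (suc k))

-- Vertices of CW_{m,n}: the apex (joined to the top cycle C^1, i.e. layer 0)
-- and the vertices (i , j) of the prism P_m □ C_n (layer i, position j).
data Vertex (m n : ℕ) : Set where
  apex : Vertex m n
  cell : Fin m → Fin n → Vertex m n

-- Edges of CW_{m,n} (exactly 2mn of them):
--   cyc i j     : cycle edge (i,j)—(i,j+1 mod n) in layer i      (m n edges)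
--   rung i p j  : edge (i,j)—(i+1,j) between consecutive layers  ((m-1) n edges)
--   spoke j     : edge apex—(0,j) to the top cycle                (n edges)
data Edge (m n : ℕ) : Set where
  cyc   : Fin m → Fin n → Edge m n
  rung  : (i : Fin m) → suc (toℕ i) < m → Fin n → Edge m n
  spoke : Fin n → Edge m n

ends : ∀ {m n} → Edge m n → Vertex m n × Vertex m n
ends (cyc i j)    = cell i j , cell i (next j)
ends {suc m} (spoke j) = apex , cell Data.Fin.zero j
ends {zero}  (spoke j) = apex , apex   -- unreachable in use (m ≥ 2)
ends (rung i p j) = cell i j , cell (fromℕ< p) j

module _ {c ℓ : Level} (G : AbelianGroup c ℓ) where
  open AbelianGroup G

  _·_ : ℕ → Carrier → Carrier
  zero  · g = ε
  suc k · g = g ∙ (k · g)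

  HasOrder : ℕ → Set (c ⊔ ℓ)
  HasOrder N = Σ (Carrier → Fin N) λ φ →
      (∀ x y → x ≈ y → φ x ≡ φ y)
    × (∀ x y → φ x ≡ φ y → x ≈ y)
    × (∀ (k : Fin N) → ∃ λ x → φ x ≡ k)

  HasCyclicSubgroupOfOrder : ℕ → Set (c ⊔ ℓ)
  HasCyclicSubgroupOfOrder d = ∃ λ g →
    (d · g ≈ ε) × (∀ k → 0 < k → k < d → ¬ (k · g ≈ ε))

  Harmonious : {V E : Set} → (E → V × V) → Set (c ⊔ ℓ)
  Harmonious {V} {E} en = Σ (V → Carrier) λ f →
    let w : E → Carrier
        w e = Data.Product.proj₁ (Data.Product.map f f (en e)) ∙ Data.Product.proj₂ (Data.Product.map f f (en e))
    in (∀ u v → f u ≈ f v → u ≡ v)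
     × (∀ e e′ → w e ≈ w e′ → e ≡ e′)
     × (∀ x → ∃ λ e → w e ≈ x)

CW-Harmonious : ∀ {c ℓ} (G : AbelianGroup c ℓ) (m n : ℕ) → Set (c ⊔ ℓ)
CW-Harmonious G m n = Harmonious G (ends {m} {n})

{-# OPTIONS --safe #-}
module Submission where

-- Let g have order 2m. Choose h₁, h₂, … greedily, each outside the subgroup generated by g and
-- the earlier choices, with kᵢ + 1 its order modulo that subgroup. Then every element of Γ is
-- uniquely Σ dᵢ hᵢ + l g with 0 ≤ dᵢ ≤ kᵢ and 0 ≤ l < 2m, and adding two such expressions
-- digit by digit, without carries, agrees with the group law. Counting gives ∏ (kᵢ + 1) = n, so
-- every kᵢ + 1 is odd, and the box ∏ [0, kᵢ] has a cyclic ordering label₀, …, label_{n-1} whose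
-- carry-free consecutive sums label_t + label_{t+1} are shift + sum_t for a permutation sum of
-- the box: on a single odd range [0, 2κ] use the zigzag κ, 2κ, κ-1, 2κ-1, …, 0, κ+1, and combine
-- the digits row by row. Giving vertex (i, j) the element with box coordinate label_{i+j mod n}
-- and l = i, and the apex (shift, 2m-1), the cycle edges, rungs and spokes receive, up to the
-- common translate (shift, 0), the elements with l even, l odd below 2m-1, and l = 2m-1, each once.

open import Data.Nat using (ℕ; zero; suc; pred; ⌊_/2⌋; _≟_; _+_; _*_; _∸_; _≤_; _<_; _≤?_; _<?_; z≤n; s≤s; z<s; NonZero; >-nonZero⁻¹)
open import Data.Nat.Properties
open import Data.Nat.DivMod
open import Data.Nat.Divisibility using (n∣m*n)
open import Data.Fin using (Fin; toℕ; fromℕ<)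
import Data.Fin.Properties as Fin
open import Defs using (HasOrder; HasCyclicSubgroupOfOrder; _·_; Vertex; apex; cell; Edge; cyc; rung; spoke; ends; next; CW-Harmonious)
open import Data.Empty using (⊥-elim)
open import Data.Product using (∃; _×_; _,_; proj₁; proj₂)
open import Data.Sum using (_⊎_; inj₁; inj₂)
open import Data.Unit using (⊤)
open import Data.List using (List; []; _∷_; _++_; map)
open import Data.List.Properties using (map-++)
open import Level using (Level; _⊔_)
open import Algebra.Bundles using (AbelianGroup)
open import Relation.Nullary using (¬_; Dec; yes; no)
open import Relation.Unary using (Decidable)
open import Relation.Binary.PropositionalEquality
  using (_≡_; _≢_; refl; sym; trans; cong; cong₂; subst; subst₂; module ≡-Reasoning)
open import Data.Nat.Tactic.RingSolver using (solve-∀)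

data Parity : ℕ → Set where
  even : ∀ c → Parity (c + c)
  odd  : ∀ c → Parity (suc (c + c))

parity : ∀ n → Parity n
parity zero = even 0
parity (suc n) with parity n
... | even c = odd c
... | odd c  = subst Parity (cong suc (+-suc c c)) (even (suc c))

c+c≤1+d+d⇒c≤d : ∀ {c d} → c + c ≤ suc (d + d) → c ≤ d
c+c≤1+d+d⇒c≤d {c} {d} le = subst₂ _≤_ (sym (n≡⌊n+n/2⌋ c)) (sym (n≡⌈n+n/2⌉ d)) (⌊n/2⌋-mono le)

1+c+c≤d+d⇒c<d : ∀ {c d} → suc (c + c) ≤ d + d → c < d
1+c+c≤d+d⇒c<d {c} {d} le = subst₂ _≤_ (cong suc (sym (n≡⌊n+n/2⌋ c))) (sym (n≡⌈n+n/2⌉ d)) (⌈n/2⌉-mono le)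

c+c≡d+d⇒c≡d : ∀ {c d} → c + c ≡ d + d → c ≡ d
c+c≡d+d⇒c≡d {c} {d} eq = trans (n≡⌊n+n/2⌋ c) (trans (cong ⌊_/2⌋ eq) (sym (n≡⌊n+n/2⌋ d)))

c+c≢1+d+d : ∀ c d → c + c ≢ suc (d + d)
c+c≢1+d+d c d eq = even≢odd c d (trans (cong (c +_) (+-identityʳ c)) (trans eq (cong (λ i → suc (d + i)) (sym (+-identityʳ d)))))

module _ {s : ℕ} .{{_ : NonZero s}} where

  [d+qs]%s≡d : ∀ {d} q → d < s → (d + q * s) % s ≡ d
  [d+qs]%s≡d {d} q d<s = trans ([m+kn]%n≡m%n d q s) (m<n⇒m%n≡m d<s)

  [d+qs]/s≡q : ∀ {d} q → d < s → (d + q * s) / s ≡ q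
  [d+qs]/s≡q {d} q d<s = begin
    (d + q * s) / s     ≡⟨ +-distrib-/-∣ʳ d (n∣m*n q) ⟩
    d / s + q * s / s   ≡⟨ cong₂ _+_ (m<n⇒m/n≡0 d<s) (m*n/n≡m q s) ⟩
    q                   ∎
    where open ≡-Reasoning

  d+qs<rs : ∀ {d q r} → d < s → q < r → d + q * s < r * s
  d+qs<rs {d} {q} d<s q<r = ≤-trans (+-monoˡ-< (q * s) d<s) (*-monoˡ-≤ s q<r)

  d+qs-injective : ∀ {d q d′ q′} → d < s → d′ < s → d + q * s ≡ d′ + q′ * s → d ≡ d′ × q ≡ q′
  d+qs-injective {d} {q} {d′} {q′} d<s d′<s eq =
      trans (sym ([d+qs]%s≡d q d<s)) (trans (cong (_% s) eq) ([d+qs]%s≡d q′ d′<s))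
    , trans (sym ([d+qs]/s≡q q d<s)) (trans (cong (_/ s) eq) ([d+qs]/s≡q q′ d′<s))

module _ {p} {P : ℕ → Set p} (P? : Decidable P) where

  private
    scan : ∀ r x → 0 < x → (∀ {d} → 0 < d → d < x → ¬ P d) → P (r + x) →
           ∃ λ d₀ → 0 < d₀ × P d₀ × (∀ {d} → 0 < d → d < d₀ → ¬ P d)
    scan r x 0<x below Pr+x with P? x
    ... | yes Px = x , 0<x , Px , below
    scan zero     x 0<x below Px   | no ¬Px = ⊥-elim (¬Px Px)
    scan (suc r) x 0<x below Pr+x | no ¬Px = scan r (suc x) z<s below′ (subst P (sym (+-suc r x)) Pr+x)
      where
      below′ : ∀ {d} → 0 < d → d < suc x → ¬ P d
      below′ 0<d d<1+x with m<1+n⇒m<n∨m≡n d<1+x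
      ... | inj₁ d<x  = below 0<d d<x
      ... | inj₂ refl = ¬Px

  least-positive : ∀ {d} → 0 < d → P d → ∃ λ d₀ → 0 < d₀ × P d₀ × (∀ {d} → 0 < d → d < d₀ → ¬ P d)
  least-positive {suc d} _ Pd = scan d 1 z<s (λ { z<s (s≤s ()) }) (subst P (+-comm 1 d) Pd)

record PermutesBelow (R : ℕ) (f : ℕ → ℕ) : Set where
  field
    bounded    : ∀ {t} → t < R → f t < R
    injective  : ∀ {t u} → t < R → u < R → f t ≡ f u → t ≡ u
    surjective : ∀ {x} → x < R → ∃ λ t → t < R × f t ≡ x

module Zigzag (κ : ℕ) where

  k : ℕ
  k = κ + κ

  zigzag : ℕ → ℕ
  zigzag zero          = κ
  zigzag (suc zero)    = k
  zigzag (suc (suc b)) = pred (zigzag b)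

  private
    pred-+-suc : ∀ x c {T} → x + c ≡ T → c < T → pred x + suc c ≡ T
    pred-+-suc zero    c eq c<T = ⊥-elim (<-irrefl eq c<T)
    pred-+-suc (suc x) c eq _   = trans (+-suc x c) eq

  zigzag-even : ∀ c → c ≤ κ → zigzag (c + c) + c ≡ κ
  zigzag-even zero    _ = +-identityʳ κ
  zigzag-even (suc c) c<κ rewrite +-suc c c =
    pred-+-suc (zigzag (c + c)) c (zigzag-even c (<⇒≤ c<κ)) c<κ

  zigzag-odd : ∀ c → c ≤ κ → zigzag (suc (c + c)) + c ≡ k
  zigzag-odd zero    _ = +-identityʳ k
  zigzag-odd (suc c) c<κ rewrite +-suc c c =
    pred-+-suc (zigzag (suc (c + c))) c (zigzag-odd c (<⇒≤ c<κ)) (≤-trans c<κ (m≤m+n κ κ))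

  zigzag-≤ : ∀ b → zigzag b ≤ k
  zigzag-≤ zero          = m≤m+n κ κ
  zigzag-≤ (suc zero)    = ≤-refl
  zigzag-≤ (suc (suc b)) = ≤-trans pred[n]≤n (zigzag-≤ b)

  zigzag-period : zigzag (suc k) ≡ zigzag 0
  zigzag-period = +-cancelʳ-≡ κ _ κ (zigzag-odd κ ≤-refl)

  zigzag-consecutive : ∀ {b} → b ≤ k → zigzag b + zigzag (suc b) ≡ κ + (k ∸ b)
  zigzag-consecutive {b} b≤k = +-cancelʳ-≡ b _ _ (begin
    zigzag b + zigzag (suc b) + b   ≡⟨ sums (parity b) b≤k ⟩
    κ + k                           ≡⟨ cong (κ +_) (sym (m∸n+n≡m b≤k)) ⟩
    κ + (k ∸ b + b)                 ≡⟨ sym (+-assoc κ _ b) ⟩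
    κ + (k ∸ b) + b                 ∎)
    where
    open ≡-Reasoning
    sums : ∀ {b} → Parity b → b ≤ k → zigzag b + zigzag (suc b) + b ≡ κ + k
    sums (even c) b≤k = begin
      zigzag (c + c) + zigzag (suc (c + c)) + (c + c)   ≡⟨ regroup (zigzag (c + c)) _ c ⟩
      (zigzag (c + c) + c) + (zigzag (suc (c + c)) + c) ≡⟨ cong₂ _+_ (zigzag-even c c≤κ) (zigzag-odd c c≤κ) ⟩
      κ + k                                             ∎
      where
      c≤κ : c ≤ κ
      c≤κ = c+c≤1+d+d⇒c≤d (m≤n⇒m≤1+n b≤k)
      regroup : ∀ x y c → x + y + (c + c) ≡ (x + c) + (y + c)
      regroup = solve-∀
    sums (odd c) b≤k = begin
      zigzag (suc (c + c)) + zigzag (suc (suc (c + c))) + suc (c + c)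
        ≡⟨ cong (λ i → zigzag (suc (c + c)) + zigzag i + suc (c + c)) (sym (cong suc (+-suc c c))) ⟩
      zigzag (suc (c + c)) + zigzag (suc c + suc c) + suc (c + c)
        ≡⟨ regroup (zigzag (suc (c + c))) _ c ⟩
      (zigzag (suc (c + c)) + c) + (zigzag (suc c + suc c) + suc c)
        ≡⟨ cong₂ _+_ (zigzag-odd c (<⇒≤ c<κ)) (zigzag-even (suc c) c<κ) ⟩
      k + κ
        ≡⟨ +-comm k κ ⟩
      κ + k
        ∎
      where
      c<κ : c < κ
      c<κ = 1+c+c≤d+d⇒c<d b≤k
      regroup : ∀ x y c → x + y + suc (c + c) ≡ (x + c) + (y + suc c)
      regroup = solve-∀

  private
    straddle : ∀ x c c′ → x + c ≡ κ → x + c′ ≡ k → c′ ≤ κ → c ≡ 0 × c′ ≡ κ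
    straddle x c c′ x+c≡κ x+c′≡k c′≤κ =
        +-cancelˡ-≡ κ c 0 (trans (cong (_+ c) (sym x≡κ)) (trans x+c≡κ (sym (+-identityʳ κ))))
      , +-cancelˡ-≡ κ c′ κ (trans (cong (_+ c′) (sym x≡κ)) x+c′≡k)
      where
      x≡κ : x ≡ κ
      x≡κ = ≤-antisym (subst (x ≤_) x+c≡κ (m≤m+n x c)) (+-cancelʳ-≤ c′ κ x (subst (κ + c′ ≤_) (sym x+c′≡k) (+-monoʳ-≤ κ c′≤κ)))

    odd-bound : ∀ {c} → suc (c + c) ≤ suc k → c ≤ κ
    odd-bound le = c+c≤1+d+d⇒c≤d (m≤n⇒m≤1+n (≤-pred le))

  zigzag-collision : ∀ {b b′} → b ≤ suc k → b′ ≤ suc k → zigzag b ≡ zigzag b′ →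
                     b ≡ b′ ⊎ (b ≡ 0 × b′ ≡ suc k) ⊎ (b ≡ suc k × b′ ≡ 0)
  zigzag-collision {b} {b′} b≤ b′≤ eq = go (parity b) (parity b′) b≤ b′≤ eq
    where
    go : ∀ {b b′} → Parity b → Parity b′ → b ≤ suc k → b′ ≤ suc k → zigzag b ≡ zigzag b′ →
         b ≡ b′ ⊎ (b ≡ 0 × b′ ≡ suc k) ⊎ (b ≡ suc k × b′ ≡ 0)
    go (even c) (even c′) b≤ b′≤ eq = inj₁ (cong (λ i → i + i) (+-cancelˡ-≡ (zigzag (c + c)) c c′
      (trans (zigzag-even c (c+c≤1+d+d⇒c≤d b≤)) (sym (trans (cong (_+ c′) eq) (zigzag-even c′ (c+c≤1+d+d⇒c≤d b′≤)))))))
    go (odd c) (odd c′) b≤ b′≤ eq = inj₁ (cong (λ i → suc (i + i)) (+-cancelˡ-≡ (zigzag (suc (c + c))) c c′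
      (trans (zigzag-odd c (odd-bound b≤)) (sym (trans (cong (_+ c′) eq) (zigzag-odd c′ (odd-bound b′≤)))))))
    go (even c) (odd c′) b≤ b′≤ eq
      with refl , refl ← straddle (zigzag (c + c)) c c′ (zigzag-even c (c+c≤1+d+d⇒c≤d b≤))
                           (trans (cong (_+ c′) eq) (zigzag-odd c′ (odd-bound b′≤))) (odd-bound b′≤)
      = inj₂ (inj₁ (refl , refl))
    go (odd c) (even c′) b≤ b′≤ eq
      with refl , refl ← straddle (zigzag (c′ + c′)) c′ c (zigzag-even c′ (c+c≤1+d+d⇒c≤d b′≤))
                           (trans (cong (_+ c) (sym eq)) (zigzag-odd c (odd-bound b≤))) (odd-bound b≤)
      = inj₂ (inj₂ (refl , refl))

  zigzag-injective : ∀ {p b b′} → p ≤ 1 → b ≤ k → b′ ≤ k → zigzag (p + b) ≡ zigzag (p + b′) → b ≡ b′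
  zigzag-injective {p} {b} {b′} p≤1 b≤k b′≤k eq
    with zigzag-collision (+-mono-≤ p≤1 b≤k) (+-mono-≤ p≤1 b′≤k) eq
  ... | inj₁ p+b≡p+b′              = +-cancelˡ-≡ p b b′ p+b≡p+b′
  ... | inj₂ (inj₁ (p+b≡0 , p+b′≡)) = ⊥-elim (<-irrefl (subst (λ q → q + b′ ≡ suc k) (m+n≡0⇒m≡0 p p+b≡0) p+b′≡) (s≤s b′≤k))
  ... | inj₂ (inj₂ (p+b≡ , p+b′≡0)) = ⊥-elim (<-irrefl (subst (λ q → q + b ≡ suc k) (m+n≡0⇒m≡0 p p+b′≡0) p+b≡) (s≤s b≤k))

  private
    zigzag-surjective₀ : ∀ {v} → v ≤ k → ∃ λ b → b ≤ k × zigzag b ≡ v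
    zigzag-surjective₀ {v} v≤k with v ≤? κ
    ... | yes v≤κ = c + c , +-mono-≤ (m∸n≤m κ v) (m∸n≤m κ v)
                  , +-cancelʳ-≡ c _ _ (trans (zigzag-even c (m∸n≤m κ v)) (sym (m+[n∸m]≡n v≤κ)))
      where
      c : ℕ
      c = κ ∸ v
    ... | no v≰κ = suc (c + c) , +-mono-≤ c<κ (<⇒≤ c<κ)
                  , +-cancelʳ-≡ c _ _ (trans (zigzag-odd c (<⇒≤ c<κ)) (sym (m+[n∸m]≡n v≤k)))
      where
      c : ℕ
      c = k ∸ v
      c<κ : c < κ
      c<κ = subst (c <_) (m+n∸n≡m κ κ) (∸-monoʳ-< (≰⇒> v≰κ) v≤k)

  zigzag-surjective : ∀ {p v} → p ≤ 1 → v ≤ k → ∃ λ b → b ≤ k × zigzag (p + b) ≡ v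
  zigzag-surjective z≤n v≤k = zigzag-surjective₀ v≤k
  zigzag-surjective (s≤s z≤n) v≤k with zigzag-surjective₀ v≤k
  ... | zero  , _   , eq = k , ≤-refl , trans zigzag-period eq
  ... | suc b , b<k , eq = b , <⇒≤ b<k , eq

  zigzag-shift-permutes : ∀ {p} → p ≤ 1 → PermutesBelow (suc k) (λ b → zigzag (p + b))
  zigzag-shift-permutes {p} p≤1 = record
    { bounded    = λ _ → s≤s (zigzag-≤ (p + _))
    ; injective  = λ b<s b′<s → zigzag-injective p≤1 (≤-pred b<s) (≤-pred b′<s)
    ; surjective = λ v<s → let b , b≤k , eq = zigzag-surjective p≤1 (≤-pred v<s) in b , s≤s b≤k , eq
    }

reverse-permutes : ∀ k → PermutesBelow (suc k) (k ∸_)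
reverse-permutes k = record
  { bounded    = λ {b} _ → s≤s (m∸n≤m k b)
  ; injective  = λ b<s b′<s → ∸-cancelˡ-≡ (≤-pred b<s) (≤-pred b′<s)
  ; surjective = λ {x} x<s → k ∸ x , s≤s (m∸n≤m k x) , m∸[m∸n]≡n (≤-pred x<s)
  }

permutes-product : ∀ {R s} .{{_ : NonZero R}} .{{_ : NonZero s}} {F : ℕ → ℕ → ℕ} {G : ℕ → ℕ} →
                   PermutesBelow R G → (∀ {a} → a < R → PermutesBelow s (F a)) →
                   PermutesBelow (R * s) (λ t → F (t % R) (t / R) + G (t % R) * s)
permutes-product {R} {s} {F} {G} PG PF = record
  { bounded    = λ t< → d+qs<rs (F.bounded (a< _) (b< t<)) (G.bounded (a< _))
  ; injective  = injective
  ; surjective = surjective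
  }
  where
  module G = PermutesBelow PG
  module F {a} (a<R : a < R) = PermutesBelow (PF a<R)

  a< : ∀ t → t % R < R
  a< t = m%n<n t R

  b< : ∀ {t} → t < R * s → t / R < s
  b< {t} t< = m<n*o⇒m/o<n (subst (t <_) (*-comm R s) t<)

  injective : ∀ {t u} → t < R * s → u < R * s →
              F (t % R) (t / R) + G (t % R) * s ≡ F (u % R) (u / R) + G (u % R) * s → t ≡ u
  injective {t} {u} t< u< eq with d+qs-injective (F.bounded (a< t) (b< t<)) (F.bounded (a< u) (b< u<)) eq
  ... | Fe , Ge with G.injective (a< t) (a< u) Ge
  ... | a≡ = begin
    t                     ≡⟨ m≡m%n+[m/n]*n t R ⟩
    t % R + t / R * R     ≡⟨ cong₂ (λ a b → a + b * R) a≡ b≡ ⟩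
    u % R + u / R * R     ≡⟨ sym (m≡m%n+[m/n]*n u R) ⟩
    u                     ∎
    where
    open ≡-Reasoning
    b≡ : t / R ≡ u / R
    b≡ = F.injective (a< u) (b< t<) (b< u<) (subst (λ a → F a (t / R) ≡ F (u % R) (u / R)) a≡ Fe)

  surjective : ∀ {x} → x < R * s → ∃ λ t → t < R * s × F (t % R) (t / R) + G (t % R) * s ≡ x
  surjective {x} x< with G.surjective (m<n*o⇒m/o<n x<)
  ... | a , a<R , Ga≡ with F.surjective a<R (m%n<n x s)
  ... | b , b<s , Fab≡ = a + b * R , subst (a + b * R <_) (*-comm s R) (d+qs<rs a<R b<s) , (begin
    F ((a + b * R) % R) ((a + b * R) / R) + G ((a + b * R) % R) * s
      ≡⟨ cong₂ (λ a′ b′ → F a′ b′ + G a′ * s) ([d+qs]%s≡d b a<R) ([d+qs]/s≡q b a<R) ⟩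
    F a b + G a * s       ≡⟨ cong₂ (λ d q → d + q * s) Fab≡ Ga≡ ⟩
    x % s + x / s * s     ≡⟨ sym (m≡m%n+[m/n]*n x s) ⟩
    x                     ∎)
    where open ≡-Reasoning

capacity : List ℕ → ℕ
capacity []       = 1
capacity (k ∷ ks) = capacity ks * suc k

capacity-nonZero : ∀ ks → NonZero (capacity ks)
capacity-nonZero []       = _
capacity-nonZero (k ∷ ks) = m*n≢0 (capacity ks) (suc k) {{capacity-nonZero ks}}

capacity-++ : ∀ ks ks′ → capacity (ks ++ ks′) ≡ capacity ks * capacity ks′
capacity-++ []       ks′ = sym (+-identityʳ (capacity ks′))
capacity-++ (k ∷ ks) ks′ = trans (cong (_* suc k) (capacity-++ ks ks′)) (swap (capacity ks) (capacity ks′) (suc k))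
  where
  swap : ∀ a b c → a * b * c ≡ a * c * b
  swap = solve-∀

DigitSums≡ : List ℕ → ℕ → ℕ → ℕ → ℕ → Set
DigitSums≡ []       x y z w = ⊤
DigitSums≡ (k ∷ ks) x y z w = x % suc k + y % suc k ≡ z % suc k + w % suc k
                            × DigitSums≡ ks (x / suc k) (y / suc k) (z / suc k) (w / suc k)

DigitSums≡-cons : ∀ {k ks d₁ d₂ d₃ d₄} q₁ q₂ q₃ q₄ →
                  d₁ < suc k → d₂ < suc k → d₃ < suc k → d₄ < suc k →
                  d₁ + d₂ ≡ d₃ + d₄ → DigitSums≡ ks q₁ q₂ q₃ q₄ →
                  DigitSums≡ (k ∷ ks) (d₁ + q₁ * suc k) (d₂ + q₂ * suc k) (d₃ + q₃ * suc k) (d₄ + q₄ * suc k)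
DigitSums≡-cons q₁ q₂ q₃ q₄ d₁< d₂< d₃< d₄< eq sums
  rewrite [d+qs]%s≡d q₁ d₁< | [d+qs]%s≡d q₂ d₂< | [d+qs]%s≡d q₃ d₃< | [d+qs]%s≡d q₄ d₄<
        | [d+qs]/s≡q q₁ d₁< | [d+qs]/s≡q q₂ d₂< | [d+qs]/s≡q q₃ d₃< | [d+qs]/s≡q q₄ d₄<
  = eq , sums

DigitSums≡-comm : ∀ ks x y → DigitSums≡ ks x y y x
DigitSums≡-comm []       x y = _
DigitSums≡-comm (k ∷ ks) x y = +-comm (x % suc k) (y % suc k) , DigitSums≡-comm ks (x / suc k) (y / suc k)

-- Numbers below capacity ks are read in the mixed radix (suc k for k in ks, least significant
-- digit first). label is a cyclic ordering of them whose consecutive members add, digitwise and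
-- without carries, to sum t + shift, where sum is again a permutation.
record HarmoniousCycle (ks : List ℕ) : Set where
  field
    label sum      : ℕ → ℕ
    shift          : ℕ
    label-permutes : PermutesBelow (capacity ks) label
    sum-permutes   : PermutesBelow (capacity ks) sum
    shift<         : shift < capacity ks
    consecutive    : ∀ {t} → suc t < capacity ks → DigitSums≡ ks (label t) (label (suc t)) (sum t) shift
    closing        : DigitSums≡ ks (label (pred (capacity ks))) (label 0) (sum (pred (capacity ks))) shift

trivialCycle : HarmoniousCycle []
trivialCycle = record
  { label = λ _ → 0 ; sum = λ _ → 0 ; shift = 0
  ; label-permutes = permutes-1 ; sum-permutes = permutes-1 ; shift< = s≤s z≤n
  ; consecutive = λ _ → _ ; closing = _ }
  where
  permutes-1 : PermutesBelow 1 (λ _ → 0)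
  permutes-1 = record
    { bounded    = λ _ → s≤s z≤n
    ; injective  = λ { (s≤s z≤n) (s≤s z≤n) _ → refl }
    ; surjective = λ { (s≤s z≤n) → 0 , s≤s z≤n , refl } }

module _ {ks} (H : HarmoniousCycle ks) where
  open HarmoniousCycle H

  private
    instance
      R-nonZero : NonZero (capacity ks)
      R-nonZero = capacity-nonZero ks

  consecutive-cyclic : ∀ {t} → t < capacity ks →
                       DigitSums≡ ks (label t) (label (suc t % capacity ks)) (sum t) shift
  consecutive-cyclic {t} t< with suc t <? capacity ks
  ... | yes st< = subst (λ u → DigitSums≡ ks (label t) (label u) (sum t) shift) (sym (m<n⇒m%n≡m st<)) (consecutive st<)
  ... | no st≮ = subst₂ (λ v u → DigitSums≡ ks (label v) (label u) (sum v) shift) t≡ 0≡ closing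
    where
    st≡R : suc t ≡ capacity ks
    st≡R = ≤-antisym t< (≮⇒≥ st≮)
    t≡ : pred (capacity ks) ≡ t
    t≡ = cong pred (sym st≡R)
    0≡ : 0 ≡ suc t % capacity ks
    0≡ = sym (trans (cong (_% capacity ks) st≡R) (n%n≡0 (capacity ks)))

bit : ℕ → ℕ
bit zero          = 0
bit (suc zero)    = 1
bit (suc (suc a)) = bit a

bit-flip : ∀ a → (bit a ≡ 0 × bit (suc a) ≡ 1) ⊎ (bit a ≡ 1 × bit (suc a) ≡ 0)
bit-flip zero          = inj₁ (refl , refl)
bit-flip (suc zero)    = inj₂ (refl , refl)
bit-flip (suc (suc a)) = bit-flip a

bit-≤1 : ∀ a → bit a ≤ 1
bit-≤1 a with bit-flip a
... | inj₁ (b≡0 , _) = subst (_≤ 1) (sym b≡0) z≤n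
... | inj₂ (b≡1 , _) = subst (_≤ 1) (sym b≡1) ≤-refl

bit-even : ∀ c → bit (c + c) ≡ 0
bit-even zero    = refl
bit-even (suc c) rewrite +-suc c c = bit-even c

-- Position t = a + b * R runs through the old cycle (column a) once per row b. The new lowest
-- digit is zigzag b, taken one step ahead in odd columns, so consecutive positions in a row
-- carry the digits zigzag b and zigzag (b + 1) in some order; as R is odd the last column
-- a = R - 1 is even, so passing to the next row continues the zigzag.
module ProductCycle {ks} (H : HarmoniousCycle ks) {j} (R-odd : capacity ks ≡ suc (j + j)) (κ : ℕ) where
  open Zigzag κ
  open HarmoniousCycle H renaming
    (label to label′; sum to sum′; shift to shift′; label-permutes to label′-permutes;
     sum-permutes to sum′-permutes; shift< to shift′<; consecutive to consecutive′; closing to closing′)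

  R s : ℕ
  R = capacity ks
  s = suc k

  instance
    R-nonZero : NonZero R
    R-nonZero = capacity-nonZero ks

  label sum : ℕ → ℕ
  label t = zigzag (bit (t % R) + t / R) + label′ (t % R) * s
  sum t   = (k ∸ t / R) + sum′ (t % R) * s

  shift : ℕ
  shift = κ + shift′ * s

  private
    zigzag-bit-consecutive : ∀ a {b} → b ≤ k → zigzag (bit a + b) + zigzag (bit (suc a) + b) ≡ (k ∸ b) + κ
    zigzag-bit-consecutive a {b} b≤k with bit-flip a
    ... | inj₁ (e₀ , e₁) rewrite e₀ | e₁ = trans (zigzag-consecutive b≤k) (+-comm κ _)
    ... | inj₂ (e₁ , e₀) rewrite e₀ | e₁ =
      trans (+-comm (zigzag (suc b)) (zigzag b)) (trans (zigzag-consecutive b≤k) (+-comm κ _))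

    sums-at : ∀ {a a′} b b′ → a < R → a′ < R → b < s → b′ < s →
              zigzag (bit a + b) + zigzag (bit a′ + b′) ≡ (k ∸ b) + κ →
              DigitSums≡ ks (label′ a) (label′ a′) (sum′ a) shift′ →
              DigitSums≡ (k ∷ ks) (label (a + b * R)) (label (a′ + b′ * R)) (sum (a + b * R)) shift
    sums-at {a} {a′} b b′ a< a′< b< b′< low high
      rewrite [d+qs]%s≡d b a< | [d+qs]/s≡q b a< | [d+qs]%s≡d b′ a′< | [d+qs]/s≡q b′ a′< =
      DigitSums≡-cons (label′ a) (label′ a′) (sum′ a) shift′
        (s≤s (zigzag-≤ (bit a + b))) (s≤s (zigzag-≤ (bit a′ + b′))) (s≤s (m∸n≤m k b)) (s≤s (m≤m+n κ κ)) low high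

    position : ∀ {t} → t < R * s → ∃ λ a → ∃ λ b → a < R × b < s × t ≡ a + b * R
    position {t} t< = t % R , t / R , m%n<n t R , m<n*o⇒m/o<n (subst (t <_) (*-comm R s) t<) , m≡m%n+[m/n]*n t R

    jj<R : j + j < R
    jj<R = subst (j + j <_) (sym R-odd) ≤-refl

    last-column : DigitSums≡ ks (label′ (j + j)) (label′ 0) (sum′ (j + j)) shift′
    last-column = subst (λ i → DigitSums≡ ks (label′ i) (label′ 0) (sum′ i) shift′) (cong pred R-odd) closing′

    row-change : ∀ {b} → b < k → DigitSums≡ (k ∷ ks) (label (j + j + b * R)) (label (0 + suc b * R)) (sum (j + j + b * R)) shift
    row-change {b} b<k = sums-at b (suc b) jj<R (≤-trans (s≤s z≤n) jj<R) (s≤s (<⇒≤ b<k)) (s≤s b<k) low last-column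
      where
      low : zigzag (bit (j + j) + b) + zigzag (suc b) ≡ (k ∸ b) + κ
      low rewrite bit-even j = trans (zigzag-consecutive (<⇒≤ b<k)) (+-comm κ _)

  consecutive : ∀ {t} → suc t < R * s → DigitSums≡ (k ∷ ks) (label t) (label (suc t)) (sum t) shift
  consecutive st< with position (<⇒≤ st<)
  ... | a , b , a< , b< , refl with suc a <? R
  ... | yes sa< = sums-at b b a< sa< b< b< (zigzag-bit-consecutive a (≤-pred b<)) (consecutive′ sa<)
  ... | no sa≮ with +-cancelˡ-≡ 1 a (j + j) (trans (≤-antisym a< (≮⇒≥ sa≮)) R-odd)
  ... | refl = subst (λ u → DigitSums≡ (k ∷ ks) (label (j + j + b * R)) (label u) (sum (j + j + b * R)) shift)
                     (sym next-row) (row-change (≤-pred (*-cancelʳ-< R (suc b) s (subst₂ _<_ next-row (*-comm R s) st<))))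
    where
    next-row : suc (j + j + b * R) ≡ suc b * R
    next-row = cong (_+ b * R) (sym R-odd)

  closing : DigitSums≡ (k ∷ ks) (label (pred (R * s))) (label 0) (sum (pred (R * s))) shift
  closing = subst (λ u → DigitSums≡ (k ∷ ks) (label u) (label 0) (sum u) shift) (sym last≡)
                  (sums-at k 0 jj<R (≤-trans (s≤s z≤n) jj<R) ≤-refl (s≤s z≤n) low last-column)
    where
    last≡ : pred (R * s) ≡ j + j + k * R
    last≡ rewrite R-odd = expand j k
      where
      expand : ∀ j k → k + (j + j) * suc k ≡ j + j + k * suc (j + j)
      expand = solve-∀
    low : zigzag (bit (j + j) + k) + zigzag 0 ≡ (k ∸ k) + κ
    low rewrite bit-even j = trans (cong (zigzag k +_) (sym zigzag-period)) (trans (zigzag-consecutive ≤-refl) (+-comm κ _))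

  cycle : HarmoniousCycle (k ∷ ks)
  cycle = record
    { label = label ; sum = sum ; shift = shift
    ; label-permutes = permutes-product label′-permutes (λ {a} _ → zigzag-shift-permutes (bit-≤1 a))
    ; sum-permutes   = permutes-product sum′-permutes (λ _ → reverse-permutes k)
    ; shift<         = d+qs<rs (s≤s (m≤m+n κ κ)) shift′<
    ; consecutive    = consecutive
    ; closing        = closing
    }

Odd : ℕ → Set
Odd x = ∃ λ j → x ≡ suc (j + j)

odd-*ˡ : ∀ x y → Odd (x * y) → Odd x
odd-*ˡ x y (j , xy≡) with parity x
... | even c = ⊥-elim (c+c≢1+d+d (c * y) j (trans (sym (*-distribʳ-+ y c c)) xy≡))
... | odd c  = c , refl

n%2≡1⇒Odd : ∀ n → n % 2 ≡ 1 → Odd n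
n%2≡1⇒Odd n n%2≡1 = n / 2 , trans (m≡m%n+[m/n]*n n 2)
  (cong₂ _+_ n%2≡1 (trans (*-comm (n / 2) 2) (cong (n / 2 +_) (+-identityʳ (n / 2)))))

harmoniousCycle : ∀ ks → Odd (capacity ks) → HarmoniousCycle ks
harmoniousCycle []       _   = trivialCycle
harmoniousCycle (k ∷ ks) kks-odd
  with odd-*ˡ (suc k) (capacity ks) (subst Odd (*-comm (capacity ks) (suc k)) kks-odd)
     | odd-*ˡ (capacity ks) (suc k) kks-odd
... | κ , refl | j , R-odd = ProductCycle.cycle (harmoniousCycle ks (j , R-odd)) {j} R-odd κ

module Expansion {c ℓ} (G : AbelianGroup c ℓ) where
  open AbelianGroup G renaming (refl to ≈-refl; sym to ≈-sym; trans to ≈-trans; reflexive to ≈-reflexive)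
  open import Algebra.Properties.Group group using (∙-cancelˡ; x≈z//y; inverseʳ-unique; ε⁻¹≈ε)
  open import Algebra.Properties.AbelianGroup G using (⁻¹-∙-comm)
  open import Algebra.Properties.CommutativeSemigroup commutativeSemigroup using (interchange; x∙yz≈y∙xz)
  open import Algebra.Properties.Monoid.Mult monoid using (×-homo-+; ×-congˡ; ×-assocˡ) renaming (_×_ to _×ᵍ_)
  open import Relation.Binary.Reasoning.Setoid setoid

  moduli : List (Carrier × ℕ) → List ℕ
  moduli = map proj₂

  expand : List (Carrier × ℕ) → ℕ → Carrier
  expand []            x = ε
  expand ((h , k) ∷ L) x = (x % suc k) ×ᵍ h ∙ expand L (x / suc k)

  expand-digitSums : ∀ L {x y z w} → DigitSums≡ (moduli L) x y z w → expand L x ∙ expand L y ≈ expand L z ∙ expand L w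
  expand-digitSums []            _                  = ≈-refl
  expand-digitSums ((h , k) ∷ L) {x} {y} {z} {w} (low , high) = begin
    (x % s) ×ᵍ h ∙ expand L (x / s) ∙ ((y % s) ×ᵍ h ∙ expand L (y / s)) ≈⟨ interchange _ _ _ _ ⟩
    ((x % s) ×ᵍ h ∙ (y % s) ×ᵍ h) ∙ (expand L (x / s) ∙ expand L (y / s))
      ≈⟨ ∙-cong (≈-sym (×-homo-+ h (x % s) (y % s))) (expand-digitSums L high) ⟩
    (x % s + y % s) ×ᵍ h ∙ (expand L (z / s) ∙ expand L (w / s))          ≈⟨ ∙-cong (×-congˡ low) ≈-refl ⟩
    (z % s + w % s) ×ᵍ h ∙ (expand L (z / s) ∙ expand L (w / s))          ≈⟨ ∙-cong (×-homo-+ h (z % s) (w % s)) ≈-refl ⟩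
    ((z % s) ×ᵍ h ∙ (w % s) ×ᵍ h) ∙ (expand L (z / s) ∙ expand L (w / s)) ≈⟨ interchange _ _ _ _ ⟩
    (z % s) ×ᵍ h ∙ expand L (z / s) ∙ ((w % s) ×ᵍ h ∙ expand L (w / s))   ∎
    where
    s : ℕ
    s = suc k

  expand-++ : ∀ B {L} b x → b < capacity (moduli B) →
              expand (B ++ L) (b + x * capacity (moduli B)) ≈ expand B b ∙ expand L x
  expand-++ []            {L} zero    x _ = ≈-trans (≈-reflexive (cong (expand L) (*-identityʳ x))) (≈-sym (identityˡ _))
  expand-++ []                (suc b) x (s≤s ())
  expand-++ ((h , k) ∷ B) {L} b x b< = begin
    (y % s) ×ᵍ h ∙ expand (B ++ L) (y / s)              ≈⟨ ∙-cong (×-congˡ low) (≈-reflexive (cong (expand (B ++ L)) high)) ⟩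
    (b % s) ×ᵍ h ∙ expand (B ++ L) (b / s + x * C)      ≈⟨ ∙-cong ≈-refl (expand-++ B (b / s) x (m<n*o⇒m/o<n b<)) ⟩
    (b % s) ×ᵍ h ∙ (expand B (b / s) ∙ expand L x)      ≈⟨ ≈-sym (assoc _ _ _) ⟩
    (b % s) ×ᵍ h ∙ expand B (b / s) ∙ expand L x        ∎
    where
    s C y : ℕ
    s = suc k
    C = capacity (moduli B)
    y = b + x * (C * s)
    y≡ : y ≡ b % s + (b / s + x * C) * s
    y≡ = trans (cong (_+ x * (C * s)) (m≡m%n+[m/n]*n b s)) (regroup (b % s) (b / s) x C s)
      where
      regroup : ∀ d q x C s → d + q * s + x * (C * s) ≡ d + (q + x * C) * s
      regroup = solve-∀
    low : y % s ≡ b % s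
    low = trans (cong (_% s) y≡) ([d+qs]%s≡d (b / s + x * C) (m%n<n b s))
    high : y / s ≡ b / s + x * C
    high = trans (cong (_/ s) y≡) ([d+qs]/s≡q (b / s + x * C) (m%n<n b s))

  infix 4 _∈⟨_⟩
  _∈⟨_⟩ : Carrier → List (Carrier × ℕ) → Set ℓ
  a ∈⟨ L ⟩ = ∃ λ x → x < capacity (moduli L) × expand L x ≈ a

  ∈-resp-≈ : ∀ {L a b} → a ≈ b → a ∈⟨ L ⟩ → b ∈⟨ L ⟩
  ∈-resp-≈ a≈b (x , x< , eq) = x , x< , ≈-trans eq a≈b

  ε∈ : ∀ L → ε ∈⟨ L ⟩
  ε∈ L = 0 , >-nonZero⁻¹ _ {{capacity-nonZero (moduli L)}} , expand-0 L
    where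
    expand-0 : ∀ L → expand L 0 ≈ ε
    expand-0 []            = ≈-refl
    expand-0 ((h , k) ∷ L) = ≈-trans (identityˡ _) (expand-0 L)

  record UniqueExpansion (L : List (Carrier × ℕ)) : Set (c ⊔ ℓ) where
    field
      expand-injective : ∀ {x y} → x < capacity (moduli L) → y < capacity (moduli L) →
                         expand L x ≈ expand L y → x ≡ y
      ∙-closed         : ∀ {a b} → a ∈⟨ L ⟩ → b ∈⟨ L ⟩ → a ∙ b ∈⟨ L ⟩
      ⁻¹-closed        : ∀ {a} → a ∈⟨ L ⟩ → a ⁻¹ ∈⟨ L ⟩

    ×ᵍ-closed : ∀ q {a} → a ∈⟨ L ⟩ → q ×ᵍ a ∈⟨ L ⟩
    ×ᵍ-closed zero    _  = ε∈ L
    ×ᵍ-closed (suc q) a∈ = ∙-closed a∈ (×ᵍ-closed q a∈)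

  uniqueExpansion-[] : UniqueExpansion []
  uniqueExpansion-[] = record
    { expand-injective = λ { (s≤s z≤n) (s≤s z≤n) _ → refl }
    ; ∙-closed         = λ { (_ , _ , a≈) (_ , _ , b≈) → 0 , s≤s z≤n , ≈-trans (≈-sym (identityˡ ε)) (∙-cong a≈ b≈) }
    ; ⁻¹-closed        = λ { (_ , _ , a≈) → 0 , s≤s z≤n , ≈-trans (≈-sym ε⁻¹≈ε) (⁻¹-cong a≈) }
    }

  ⁻¹-of-summand : ∀ {x y u} → x ∙ y ≈ u → y ⁻¹ ≈ x ∙ u ⁻¹
  ⁻¹-of-summand {x} {y} {u} xy≈u = ≈-sym (inverseʳ-unique y (x ∙ u ⁻¹) (begin
    y ∙ (x ∙ u ⁻¹)    ≈⟨ x∙yz≈y∙xz y x (u ⁻¹) ⟩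
    x ∙ (y ∙ u ⁻¹)    ≈⟨ ≈-sym (assoc x y (u ⁻¹)) ⟩
    x ∙ y ∙ u ⁻¹      ≈⟨ ∙-cong xy≈u ≈-refl ⟩
    u ∙ u ⁻¹          ≈⟨ inverseʳ u ⟩
    ε                 ∎))

  -- k + 1 is the order of z modulo the subgroup ⟨L⟩, so (d , w) ↦ d z ∙ w is a bijection
  -- from [0, k] × ⟨L⟩ onto ⟨(z , k) ∷ L⟩.
  module Extend {L} (U : UniqueExpansion L) {z k} (carry : suc k ×ᵍ z ∈⟨ L ⟩)
                (minimal : ∀ {d} → 0 < d → d ≤ k → ¬ (d ×ᵍ z ∈⟨ L ⟩)) where
    open UniqueExpansion U

    private
      L′ : List (Carrier × ℕ)
      L′ = (z , k) ∷ L

      s : ℕ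
      s = suc k

      ∈-cons : ∀ {d w} → d ≤ k → w ∈⟨ L ⟩ → d ×ᵍ z ∙ w ∈⟨ L′ ⟩
      ∈-cons {d} d≤k (q , q< , q≈) = d + q * s , d+qs<rs (s≤s d≤k) q<
        , ∙-cong (×-congˡ ([d+qs]%s≡d q (s≤s d≤k))) (≈-trans (≈-reflexive (cong (expand L) ([d+qs]/s≡q q (s≤s d≤k)))) q≈)

      ∈-uncons : ∀ {a} → a ∈⟨ L′ ⟩ → ∃ λ d → ∃ λ w → d ≤ k × w ∈⟨ L ⟩ × a ≈ d ×ᵍ z ∙ w
      ∈-uncons (x , x< , x≈) = x % s , expand L (x / s) , ≤-pred (m%n<n x s)
                             , (x / s , m<n*o⇒m/o<n x< , ≈-refl) , ≈-sym x≈

      ×ᵍ-∈ : ∀ d {w} → w ∈⟨ L ⟩ → d ×ᵍ z ∙ w ∈⟨ L′ ⟩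
      ×ᵍ-∈ d {w} w∈ = ∈-resp-≈ {L′} (≈-sym regroup) (∈-cons (≤-pred (m%n<n d s)) (∙-closed (×ᵍ-closed (d / s) carry) w∈))
        where
        regroup : d ×ᵍ z ∙ w ≈ (d % s) ×ᵍ z ∙ ((d / s) ×ᵍ (s ×ᵍ z) ∙ w)
        regroup = begin
          d ×ᵍ z ∙ w                                  ≈⟨ ∙-cong (×-congˡ (m≡m%n+[m/n]*n d s)) ≈-refl ⟩
          (d % s + d / s * s) ×ᵍ z ∙ w                ≈⟨ ∙-cong (×-homo-+ z (d % s) (d / s * s)) ≈-refl ⟩
          (d % s) ×ᵍ z ∙ (d / s * s) ×ᵍ z ∙ w         ≈⟨ assoc _ _ _ ⟩
          (d % s) ×ᵍ z ∙ ((d / s * s) ×ᵍ z ∙ w)       ≈⟨ ∙-cong ≈-refl (∙-cong (≈-sym (×-assocˡ z (d / s) s)) ≈-refl) ⟩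
          (d % s) ×ᵍ z ∙ ((d / s) ×ᵍ (s ×ᵍ z) ∙ w)    ∎

      ∙-closed′ : ∀ {a b} → a ∈⟨ L′ ⟩ → b ∈⟨ L′ ⟩ → a ∙ b ∈⟨ L′ ⟩
      ∙-closed′ {a} {b} a∈ b∈ with ∈-uncons a∈ | ∈-uncons b∈
      ... | d , w , _ , w∈ , a≈ | d′ , w′ , _ , w′∈ , b≈ =
        ∈-resp-≈ {L′} (≈-sym sum≈) (×ᵍ-∈ (d + d′) (∙-closed w∈ w′∈))
        where
        sum≈ : a ∙ b ≈ (d + d′) ×ᵍ z ∙ (w ∙ w′)
        sum≈ = begin
          a ∙ b                                   ≈⟨ ∙-cong a≈ b≈ ⟩
          (d ×ᵍ z ∙ w) ∙ (d′ ×ᵍ z ∙ w′)           ≈⟨ interchange _ _ _ _ ⟩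
          (d ×ᵍ z ∙ d′ ×ᵍ z) ∙ (w ∙ w′)           ≈⟨ ∙-cong (≈-sym (×-homo-+ z d d′)) ≈-refl ⟩
          (d + d′) ×ᵍ z ∙ (w ∙ w′)                ∎

      ⁻¹-closed′ : ∀ {a} → a ∈⟨ L′ ⟩ → a ⁻¹ ∈⟨ L′ ⟩
      ⁻¹-closed′ {a} a∈ with ∈-uncons a∈
      ... | d , w , d≤k , w∈ , a≈ =
        ∈-resp-≈ {L′} (≈-sym inv≈) (×ᵍ-∈ (s ∸ d) (∙-closed (⁻¹-closed carry) (⁻¹-closed w∈)))
        where
        complement : (s ∸ d) ×ᵍ z ∙ d ×ᵍ z ≈ s ×ᵍ z
        complement = ≈-trans (≈-sym (×-homo-+ z (s ∸ d) d)) (×-congˡ (m∸n+n≡m (m≤n⇒m≤1+n d≤k)))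
        inv≈ : a ⁻¹ ≈ (s ∸ d) ×ᵍ z ∙ ((s ×ᵍ z) ⁻¹ ∙ w ⁻¹)
        inv≈ = begin
          a ⁻¹                                      ≈⟨ ⁻¹-cong a≈ ⟩
          (d ×ᵍ z ∙ w) ⁻¹                           ≈⟨ ≈-sym (⁻¹-∙-comm _ _) ⟩
          (d ×ᵍ z) ⁻¹ ∙ w ⁻¹                        ≈⟨ ∙-cong (⁻¹-of-summand complement) ≈-refl ⟩
          (s ∸ d) ×ᵍ z ∙ (s ×ᵍ z) ⁻¹ ∙ w ⁻¹         ≈⟨ assoc _ _ _ ⟩
          (s ∸ d) ×ᵍ z ∙ ((s ×ᵍ z) ⁻¹ ∙ w ⁻¹)       ∎

      digit-cancel : ∀ {d d′ w w′} → d′ ≤ d → d ≤ k → w ∈⟨ L ⟩ → w′ ∈⟨ L ⟩ →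
                     d ×ᵍ z ∙ w ≈ d′ ×ᵍ z ∙ w′ → d ≡ d′
      digit-cancel {d} {d′} {w} {w′} d′≤d d≤k w∈ w′∈ eq with d ∸ d′ in e≡
      ... | zero  = ≤-antisym (m∸n≡0⇒m≤n e≡) d′≤d
      ... | suc e = ⊥-elim (minimal (s≤s z≤n) (subst (_≤ k) e≡ (≤-trans (m∸n≤m d d′) d≤k))
                                    (∈-resp-≈ {L} (≈-sym difference) (∙-closed w′∈ (⁻¹-closed w∈))))
        where
        d′+e≡d : d′ + suc e ≡ d
        d′+e≡d = trans (cong (d′ +_) (sym e≡)) (m+[n∸m]≡n d′≤d)
        difference : suc e ×ᵍ z ≈ w′ ∙ w ⁻¹
        difference = x≈z//y _ w w′ (∙-cancelˡ (d′ ×ᵍ z) _ _ (begin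
          d′ ×ᵍ z ∙ (suc e ×ᵍ z ∙ w)    ≈⟨ ≈-sym (assoc _ _ _) ⟩
          d′ ×ᵍ z ∙ suc e ×ᵍ z ∙ w      ≈⟨ ∙-cong (≈-sym (×-homo-+ z d′ (suc e))) ≈-refl ⟩
          (d′ + suc e) ×ᵍ z ∙ w         ≈⟨ ∙-cong (×-congˡ d′+e≡d) ≈-refl ⟩
          d ×ᵍ z ∙ w                    ≈⟨ eq ⟩
          d′ ×ᵍ z ∙ w′                  ∎))

      expand-injective′ : ∀ {x y} → x < capacity (moduli L′) → y < capacity (moduli L′) →
                          expand L′ x ≈ expand L′ y → x ≡ y
      expand-injective′ {x} {y} x< y< eq =
        trans (m≡m%n+[m/n]*n x s) (trans (cong₂ (λ d q → d + q * s) d≡ q≡) (sym (m≡m%n+[m/n]*n y s)))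
        where
        x∈ : expand L (x / s) ∈⟨ L ⟩
        x∈ = x / s , m<n*o⇒m/o<n x< , ≈-refl
        y∈ : expand L (y / s) ∈⟨ L ⟩
        y∈ = y / s , m<n*o⇒m/o<n y< , ≈-refl
        d≡ : x % s ≡ y % s
        d≡ with ≤-total (y % s) (x % s)
        ... | inj₁ y≤x = digit-cancel y≤x (≤-pred (m%n<n x s)) x∈ y∈ eq
        ... | inj₂ x≤y = sym (digit-cancel x≤y (≤-pred (m%n<n y s)) y∈ x∈ (≈-sym eq))
        q≡ : x / s ≡ y / s
        q≡ = expand-injective (m<n*o⇒m/o<n x<) (m<n*o⇒m/o<n y<)
               (∙-cancelˡ ((x % s) ×ᵍ z) _ _ (≈-trans eq (∙-cong (×-congˡ (sym d≡)) ≈-refl)))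

    uniqueExpansion : UniqueExpansion L′
    uniqueExpansion = record
      { expand-injective = expand-injective′ ; ∙-closed = ∙-closed′ ; ⁻¹-closed = ⁻¹-closed′ }

  cyclicExpansion : ∀ {g K} → suc K ×ᵍ g ≈ ε → (∀ {d} → 0 < d → d ≤ K → ¬ (d ×ᵍ g ≈ ε)) →
                    UniqueExpansion ((g , K) ∷ [])
  cyclicExpansion g-order g-minimal = Extend.uniqueExpansion uniqueExpansion-[]
    (0 , s≤s z≤n , ≈-sym g-order) (λ 0<d d≤K (_ , _ , ε≈) → g-minimal 0<d d≤K (≈-sym ε≈))

  record Coordinates (ks : List ℕ) (M : ℕ) : Set (c ⊔ ℓ) where
    field
      point            : ℕ → ℕ → Carrier
      point-injective  : ∀ {b l b′ l′} → b < capacity ks → l < M → b′ < capacity ks → l′ < M →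
                         point b l ≈ point b′ l′ → b ≡ b′ × l ≡ l′
      point-surjective : ∀ a → ∃ λ b → ∃ λ l → b < capacity ks × l < M × point b l ≈ a
      point-additive   : ∀ {b₁ b₂ b₃ b₄ l₁ l₂ l₃ l₄} → DigitSums≡ ks b₁ b₂ b₃ b₄ → l₁ + l₂ ≡ l₃ + l₄ →
                         point b₁ l₁ ∙ point b₂ l₂ ≈ point b₃ l₃ ∙ point b₄ l₄

  module _ {g K} (B : List (Carrier × ℕ)) (U : UniqueExpansion (B ++ (g , K) ∷ []))
           (spanning : ∀ a → a ∈⟨ B ++ (g , K) ∷ [] ⟩) where

    private
      R : ℕ
      R = capacity (moduli B)

      instance
        R-nonZero : NonZero R
        R-nonZero = capacity-nonZero (moduli B)

    capacity-spanning : capacity (moduli (B ++ (g , K) ∷ [])) ≡ capacity (moduli B) * suc K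
    capacity-spanning = trans (cong capacity (map-++ proj₂ B ((g , K) ∷ [])))
                          (trans (capacity-++ (moduli B) (K ∷ [])) (cong (R *_) (+-identityʳ (suc K))))

    private
      point : ℕ → ℕ → Carrier
      point b l = expand B b ∙ l ×ᵍ g

      index< : ∀ {b l} → b < R → l < suc K → b + l * R < capacity (moduli (B ++ (g , K) ∷ []))
      index< {b} {l} b< l< = subst (b + l * R <_) (trans (*-comm (suc K) R) (sym capacity-spanning)) (d+qs<rs b< l<)

      expand-index : ∀ b l → b < R → l < suc K → expand (B ++ (g , K) ∷ []) (b + l * R) ≈ point b l
      expand-index b l b< l< =
        ≈-trans (expand-++ B b l b<) (∙-cong ≈-refl (≈-trans (identityʳ _) (×-congˡ (m<n⇒m%n≡m l<))))

      point-injective : ∀ {b l b′ l′} → b < R → l < suc K → b′ < R → l′ < suc K →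
                        point b l ≈ point b′ l′ → b ≡ b′ × l ≡ l′
      point-injective {b} {l} {b′} {l′} b< l< b′< l′< eq = d+qs-injective b< b′<
        (UniqueExpansion.expand-injective U (index< b< l<) (index< b′< l′<)
          (≈-trans (expand-index b l b< l<) (≈-trans eq (≈-sym (expand-index b′ l′ b′< l′<)))))

      point-surjective : ∀ a → ∃ λ b → ∃ λ l → b < R × l < suc K × point b l ≈ a
      point-surjective a with spanning a
      ... | x , x< , x≈ = x % R , x / R , m%n<n x R , l< ,
            ≈-trans (≈-sym (expand-index (x % R) (x / R) (m%n<n x R) l<))
                    (≈-trans (≈-reflexive (cong (expand (B ++ (g , K) ∷ [])) (sym (m≡m%n+[m/n]*n x R)))) x≈)
        where
        l< : x / R < suc K
        l< = m<n*o⇒m/o<n (subst (x <_) (trans capacity-spanning (*-comm R (suc K))) x<)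

      point-additive : ∀ {b₁ b₂ b₃ b₄} l₁ l₂ l₃ l₄ → DigitSums≡ (moduli B) b₁ b₂ b₃ b₄ → l₁ + l₂ ≡ l₃ + l₄ →
                       point b₁ l₁ ∙ point b₂ l₂ ≈ point b₃ l₃ ∙ point b₄ l₄
      point-additive {b₁} {b₂} {b₃} {b₄} l₁ l₂ l₃ l₄ sums l-sums = begin
        (expand B b₁ ∙ l₁ ×ᵍ g) ∙ (expand B b₂ ∙ l₂ ×ᵍ g)  ≈⟨ interchange _ _ _ _ ⟩
        (expand B b₁ ∙ expand B b₂) ∙ (l₁ ×ᵍ g ∙ l₂ ×ᵍ g)  ≈⟨ ∙-cong (expand-digitSums B sums) (≈-sym (×-homo-+ g l₁ l₂)) ⟩
        (expand B b₃ ∙ expand B b₄) ∙ (l₁ + l₂) ×ᵍ g       ≈⟨ ∙-cong ≈-refl (×-congˡ l-sums) ⟩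
        (expand B b₃ ∙ expand B b₄) ∙ (l₃ + l₄) ×ᵍ g       ≈⟨ ∙-cong ≈-refl (×-homo-+ g l₃ l₄) ⟩
        (expand B b₃ ∙ expand B b₄) ∙ (l₃ ×ᵍ g ∙ l₄ ×ᵍ g)  ≈⟨ interchange _ _ _ _ ⟩
        (expand B b₃ ∙ l₃ ×ᵍ g) ∙ (expand B b₄ ∙ l₄ ×ᵍ g)  ∎

    spanningCoordinates : Coordinates (moduli B) (suc K)
    spanningCoordinates = record
      { point            = point
      ; point-injective  = point-injective
      ; point-surjective = point-surjective
      -- the levels have to be passed on: they cannot be recovered from the unfolded point
      ; point-additive   = λ {_} {_} {_} {_} {l₁} {l₂} {l₃} {l₄} → point-additive l₁ l₂ l₃ l₄
      }

module FiniteAbelianGroup {c ℓ} (G : AbelianGroup c ℓ) {N} (order : HasOrder G N) where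
  open AbelianGroup G renaming (refl to ≈-refl; sym to ≈-sym; trans to ≈-trans; reflexive to ≈-reflexive)
  open import Algebra.Properties.Group group using (identityˡ-unique)
  open import Algebra.Properties.Monoid.Mult monoid using (×-homo-+; ×-congˡ) renaming (_×_ to _×ᵍ_)
  open Expansion G

  private
    φ : Carrier → Fin N
    φ = proj₁ order

    φ-cong : ∀ x y → x ≈ y → φ x ≡ φ y
    φ-cong = proj₁ (proj₂ order)

    φ-injective : ∀ x y → φ x ≡ φ y → x ≈ y
    φ-injective = proj₁ (proj₂ (proj₂ order))

    φ-surjective : ∀ i → ∃ λ x → φ x ≡ i
    φ-surjective = proj₂ (proj₂ (proj₂ order))

    element : Fin N → Carrier
    element i = proj₁ (φ-surjective i)

    element-φ : ∀ a → element (φ a) ≈ a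
    element-φ a = φ-injective _ _ (proj₂ (φ-surjective (φ a)))

  _≈?_ : ∀ x y → Dec (x ≈ y)
  x ≈? y with φ x Fin.≟ φ y
  ... | yes φx≡φy = yes (φ-injective x y φx≡φy)
  ... | no  φx≢φy = no (λ x≈y → φx≢φy (φ-cong x y x≈y))

  infix 4 _∈?⟨_⟩
  _∈?⟨_⟩ : ∀ a L → Dec (a ∈⟨ L ⟩)
  a ∈?⟨ L ⟩ = anyUpTo? (λ x → expand L x ≈? a) (capacity (moduli L))

  capacity≤order : ∀ {L} → UniqueExpansion L → capacity (moduli L) ≤ N
  capacity≤order {L} U = Fin.injective⇒≤ {f = λ i → φ (expand L (toℕ i))}
    (λ eq → Fin.toℕ-injective (UniqueExpansion.expand-injective U (Fin.toℕ<n _) (Fin.toℕ<n _) (φ-injective _ _ eq)))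

  finite-order : ∀ z → ∃ λ d → 0 < d × d ×ᵍ z ≈ ε
  finite-order z with Fin.pigeonhole (n<1+n N) (λ (i : Fin (suc N)) → φ (toℕ i ×ᵍ z))
  ... | i , j , i<j , φi≡φj = toℕ j ∸ toℕ i , m<n⇒0<n∸m i<j , identityˡ-unique _ (toℕ i ×ᵍ z) (begin
    (toℕ j ∸ toℕ i) ×ᵍ z ∙ toℕ i ×ᵍ z   ≈⟨ ≈-sym (×-homo-+ z (toℕ j ∸ toℕ i) (toℕ i)) ⟩
    (toℕ j ∸ toℕ i + toℕ i) ×ᵍ z        ≈⟨ ×-congˡ (m∸n+n≡m (<⇒≤ i<j)) ⟩
    toℕ j ×ᵍ z                          ≈⟨ φ-injective _ _ (sym φi≡φj) ⟩
    toℕ i ×ᵍ z                          ∎)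
    where open import Relation.Binary.Reasoning.Setoid setoid

  order≤capacity : ∀ {L} → (∀ a → a ∈⟨ L ⟩) → N ≤ capacity (moduli L)
  order≤capacity {L} spanning = Fin.injective⇒≤ {f = index} index-injective
    where
    index : Fin N → Fin (capacity (moduli L))
    index i = fromℕ< (proj₁ (proj₂ (spanning (element i))))
    index-injective : ∀ {i j} → index i ≡ index j → i ≡ j
    index-injective {i} {j} eq =
      trans (sym (proj₂ (φ-surjective i))) (trans (φ-cong _ _ same-element) (proj₂ (φ-surjective j)))
      where
      same-index : proj₁ (spanning (element i)) ≡ proj₁ (spanning (element j))
      same-index = trans (sym (Fin.toℕ-fromℕ< _)) (trans (cong toℕ eq) (Fin.toℕ-fromℕ< _))
      same-element : element i ≈ element j
      same-element = ≈-trans (≈-sym (proj₂ (proj₂ (spanning (element i)))))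
                       (≈-trans (≈-reflexive (cong (expand L) same-index)) (proj₂ (proj₂ (spanning (element j)))))

  module _ {L : List (Carrier × ℕ)} where

    private
      grow : ∀ fuel B → UniqueExpansion (B ++ L) → N < capacity (moduli (B ++ L)) + fuel →
             ∃ λ B′ → UniqueExpansion (B′ ++ L) × (∀ a → a ∈⟨ B′ ++ L ⟩)
      grow zero B U N< = ⊥-elim (<-irrefl refl (≤-trans N< (≤-trans (≤-reflexive (+-identityʳ _)) (capacity≤order U))))
      grow (suc fuel) B U N< with Fin.all? (λ i → element i ∈?⟨ B ++ L ⟩)
      ... | yes all∈ = B , U , λ a → ∈-resp-≈ {B ++ L} (element-φ a) (all∈ (φ a))
      ... | no ¬all∈ with Fin.¬∀⟶∃¬ N _ (λ i → element i ∈?⟨ B ++ L ⟩) ¬all∈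
      ... | i , z∉ with finite-order (element i)
      ... | d , 0<d , dz≈ε with least-positive (λ d → d ×ᵍ element i ∈?⟨ B ++ L ⟩) 0<d (∈-resp-≈ {B ++ L} (≈-sym dz≈ε) (ε∈ (B ++ L)))
      ... | suc zero , _ , z∈ , _ = ⊥-elim (z∉ (∈-resp-≈ {B ++ L} (identityʳ _) z∈))
      ... | suc (suc k) , _ , carry , minimal =
        grow fuel ((element i , suc k) ∷ B) (Extend.uniqueExpansion U carry (λ 0<d d≤ → minimal 0<d (s≤s d≤))) N<′
        where
        C : ℕ
        C = capacity (moduli (B ++ L))
        N<′ : N < C * suc (suc k) + fuel
        N<′ = ≤-trans N< (≤-trans (≤-reflexive (+-suc C fuel))
                (+-monoˡ-≤ fuel (m<m*n C (suc (suc k)) {{capacity-nonZero (moduli (B ++ L))}} (s≤s (s≤s z≤n)))))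

    spanning-extension : UniqueExpansion L → ∃ λ B → UniqueExpansion (B ++ L) × (∀ a → a ∈⟨ B ++ L ⟩)
    spanning-extension U = grow (suc N) [] U (≤-trans (n<1+n N) (m≤n+m (suc N) _))

  ·≡×ᵍ : ∀ k x → _·_ G k x ≡ k ×ᵍ x
  ·≡×ᵍ zero    x = refl
  ·≡×ᵍ (suc k) x = cong (x ∙_) (·≡×ᵍ k x)

  coordinates : ∀ {K} → HasCyclicSubgroupOfOrder G (suc K) →
                ∃ λ ks → capacity ks * suc K ≡ N × Coordinates ks (suc K)
  coordinates {K} (g , g-order , g-minimal) = from-spanning (spanning-extension (cyclicExpansion g-order′ g-minimal′))
    where
    g-order′ : suc K ×ᵍ g ≈ ε
    g-order′ = ≈-trans (≈-reflexive (sym (·≡×ᵍ (suc K) g))) g-order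
    g-minimal′ : ∀ {d} → 0 < d → d ≤ K → ¬ (d ×ᵍ g ≈ ε)
    g-minimal′ {d} 0<d d≤K dg≈ε = g-minimal d 0<d (s≤s d≤K) (≈-trans (≈-reflexive (·≡×ᵍ d g)) dg≈ε)
    from-spanning : (∃ λ B → UniqueExpansion (B ++ (g , K) ∷ []) × (∀ a → a ∈⟨ B ++ (g , K) ∷ [] ⟩)) →
                    ∃ λ ks → capacity ks * suc K ≡ N × Coordinates ks (suc K)
    from-spanning (B , U , spanning) = moduli B
      , trans (sym (capacity-spanning B U spanning))
              (≤-antisym (capacity≤order U) (order≤capacity {B ++ (g , K) ∷ []} spanning))
      , spanningCoordinates B U spanning

toℕ-next : ∀ {n} .{{_ : NonZero n}} (j : Fin n) → toℕ (next j) ≡ suc (toℕ j) % n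
toℕ-next {suc _} j = Fin.toℕ-fromℕ< _

%-absorbˡ : ∀ x y n .{{_ : NonZero n}} → (x % n + y) % n ≡ (x + y) % n
%-absorbˡ x y n = begin
  (x % n + y) % n             ≡⟨ %-distribˡ-+ (x % n) y n ⟩
  (x % n % n + y % n) % n     ≡⟨ cong (λ u → (u + y % n) % n) (m%n%n≡m%n x n) ⟩
  (x % n + y % n) % n         ≡⟨ %-distribˡ-+ x y n ⟨
  (x + y) % n                 ∎
  where open ≡-Reasoning

%-absorbʳ : ∀ x y n .{{_ : NonZero n}} → (x + y % n) % n ≡ (x + y) % n
%-absorbʳ x y n = trans (cong (_% n) (+-comm x (y % n))) (trans (%-absorbˡ y x n) (cong (_% n) (+-comm y x)))

module Labelling {c ℓ} (G : AbelianGroup c ℓ) (m′ : ℕ) {ks} (H : HarmoniousCycle ks)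
                 (coords : Expansion.Coordinates G ks (suc (suc (m′ + m′)))) where
  open AbelianGroup G renaming (refl to ≈-refl; sym to ≈-sym; trans to ≈-trans; reflexive to ≈-reflexive)
  open HarmoniousCycle H
  open import Algebra.Properties.Group group using (∙-cancelʳ; //-rightDividesˡ)
  open Expansion.Coordinates coords

  m n K : ℕ
  m = suc m′
  n = capacity ks
  K = suc (m′ + m′)

  instance
    n-nonZero : NonZero n
    n-nonZero = capacity-nonZero ks

  diag : Fin m → Fin n → ℕ
  diag i j = (toℕ i + toℕ j) % n

  f : Vertex m n → Carrier
  f apex       = point shift K
  f (cell i j) = point (label (diag i j)) (toℕ i)

  code : Edge m n → ℕ × ℕ
  code (cyc i j)    = sum (diag i j) , toℕ i + toℕ i
  code (rung i _ j) = sum (diag i j) , suc (toℕ i + toℕ i)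
  code (spoke j)    = label (toℕ j) , K

  weight : Edge m n → Carrier
  weight e = f (proj₁ (ends e)) ∙ f (proj₂ (ends e))

  diag-next : ∀ i j → diag i (next j) ≡ suc (diag i j) % n
  diag-next i j = begin
    (toℕ i + toℕ (next j)) % n        ≡⟨ cong (λ u → (toℕ i + u) % n) (toℕ-next j) ⟩
    (toℕ i + suc (toℕ j) % n) % n     ≡⟨ %-absorbʳ (toℕ i) (suc (toℕ j)) n ⟩
    (toℕ i + suc (toℕ j)) % n         ≡⟨ cong (_% n) (+-suc (toℕ i) (toℕ j)) ⟩
    suc (toℕ i + toℕ j) % n           ≡⟨ %-absorbʳ 1 (toℕ i + toℕ j) n ⟨
    suc (diag i j) % n                ∎
    where open ≡-Reasoning

  diag-up : ∀ i (p : suc (toℕ i) < m) j → diag (fromℕ< p) j ≡ suc (diag i j) % n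
  diag-up i p j = trans (cong (λ u → (u + toℕ j) % n) (Fin.toℕ-fromℕ< p)) (sym (%-absorbʳ 1 (toℕ i + toℕ j) n))

  diag< : ∀ i j → diag i j < n
  diag< i j = m%n<n (toℕ i + toℕ j) n

  diag-injective : ∀ i {j j′} → diag i j ≡ diag i j′ → j ≡ j′
  diag-injective i {j} {j′} eq =
    Fin.toℕ-injective (trans (sym (recover j)) (trans (cong (λ u → (u + pred n * toℕ i) % n) eq) (recover j′)))
    where
    recover : ∀ j → (diag i j + pred n * toℕ i) % n ≡ toℕ j
    recover j = begin
      ((toℕ i + toℕ j) % n + pred n * toℕ i) % n   ≡⟨ %-absorbˡ (toℕ i + toℕ j) (pred n * toℕ i) n ⟩
      (toℕ i + toℕ j + pred n * toℕ i) % n          ≡⟨ cong (_% n) (regroup (toℕ i) (toℕ j) (pred n)) ⟩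
      (toℕ j + toℕ i * suc (pred n)) % n            ≡⟨ cong (λ u → (toℕ j + toℕ i * u) % n) (suc-pred n) ⟩
      (toℕ j + toℕ i * n) % n                       ≡⟨ [m+kn]%n≡m%n (toℕ j) (toℕ i) n ⟩
      toℕ j % n                                     ≡⟨ m<n⇒m%n≡m (Fin.toℕ<n j) ⟩
      toℕ j                                         ∎
      where
      open ≡-Reasoning
      regroup : ∀ a b c → a + b + c * a ≡ b + a * suc c
      regroup = solve-∀

  diag-surjective : ∀ i {t} → t < n → ∃ λ j → diag i j ≡ t
  diag-surjective i {t} t<n = fromℕ< (m%n<n u n) , (begin
    (toℕ i + toℕ (fromℕ< (m%n<n u n))) % n   ≡⟨ cong (λ v → (toℕ i + v) % n) (Fin.toℕ-fromℕ< _) ⟩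
    (toℕ i + u % n) % n                      ≡⟨ %-absorbʳ (toℕ i) u n ⟩
    (toℕ i + (t + pred n * toℕ i)) % n       ≡⟨ cong (_% n) (regroup (toℕ i) t (pred n)) ⟩
    (t + toℕ i * suc (pred n)) % n           ≡⟨ cong (λ v → (t + toℕ i * v) % n) (suc-pred n) ⟩
    (t + toℕ i * n) % n                      ≡⟨ [m+kn]%n≡m%n t (toℕ i) n ⟩
    t % n                                    ≡⟨ m<n⇒m%n≡m t<n ⟩
    t                                        ∎)
    where
    open ≡-Reasoning
    u : ℕ
    u = t + pred n * toℕ i
    regroup : ∀ a b c → a + (b + c * a) ≡ b + a * suc c
    regroup = solve-∀

  C : Carrier
  C = point shift 0

  weight-code : ∀ e → weight e ≈ point (proj₁ (code e)) (proj₂ (code e)) ∙ C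
  weight-code (cyc i j) =
    ≈-trans (∙-cong ≈-refl (≈-reflexive (cong (λ u → point (label u) (toℕ i)) (diag-next i j))))
            (point-additive (consecutive-cyclic H (diag< i j)) (sym (+-identityʳ _)))
  weight-code (rung i p j) =
    ≈-trans (∙-cong ≈-refl (≈-reflexive (cong₂ (λ u v → point (label u) v) (diag-up i p j) (Fin.toℕ-fromℕ< p))))
            (point-additive (consecutive-cyclic H (diag< i j)) (trans (+-suc _ _) (sym (+-identityʳ _))))
  weight-code (spoke j) =
    ≈-trans (∙-cong ≈-refl (≈-reflexive (cong (λ u → point (label u) 0) (m<n⇒m%n≡m (Fin.toℕ<n j)))))
            (point-additive (DigitSums≡-comm ks shift (label (toℕ j))) refl)

  private
    module Label = PermutesBelow label-permutes
    module Sum   = PermutesBelow sum-permutes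

    i<K : ∀ (i : Fin m) → toℕ i < K
    i<K i = s≤s (≤-trans (≤-pred (Fin.toℕ<n i)) (m≤m+n m′ m′))

    i<1+K : ∀ (i : Fin m) → toℕ i < suc K
    i<1+K i = m≤n⇒m≤1+n (i<K i)

    cell-label< : ∀ i j → label (diag i j) < n
    cell-label< i j = Label.bounded (diag< i j)

  code-bounded : ∀ e → proj₁ (code e) < n × proj₂ (code e) < suc K
  code-bounded (cyc i j)    = Sum.bounded (diag< i j) , s≤s (m≤n⇒m≤1+n (+-mono-≤ (≤-pred (Fin.toℕ<n i)) (≤-pred (Fin.toℕ<n i))))
  code-bounded (rung i p j) = Sum.bounded (diag< i j) , s≤s (s≤s (+-mono-≤ (<⇒≤ (≤-pred p)) (<⇒≤ (≤-pred p))))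
  code-bounded (spoke j)    = Label.bounded (Fin.toℕ<n j) , ≤-refl

  code-injective : ∀ e e′ → proj₁ (code e) ≡ proj₁ (code e′) → proj₂ (code e) ≡ proj₂ (code e′) → e ≡ e′
  code-injective (cyc i j) (cyc i′ j′) b≡ l≡ with Fin.toℕ-injective {i = i} {i′} (c+c≡d+d⇒c≡d l≡)
  ... | refl = cong (cyc i) (diag-injective i (Sum.injective (diag< i j) (diag< i j′) b≡))
  code-injective (rung i p j) (rung i′ p′ j′) b≡ l≡ with Fin.toℕ-injective {i = i} {i′} (c+c≡d+d⇒c≡d (suc-injective l≡))
  ... | refl = cong₂ (rung i) (≤-irrelevant p p′) (diag-injective i (Sum.injective (diag< i j) (diag< i j′) b≡))
  code-injective (spoke j) (spoke j′) b≡ l≡ = cong spoke (Fin.toℕ-injective (Label.injective (Fin.toℕ<n j) (Fin.toℕ<n j′) b≡))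
  code-injective (cyc i j)    (rung i′ p′ j′) b≡ l≡ = ⊥-elim (c+c≢1+d+d (toℕ i) (toℕ i′) l≡)
  code-injective (rung i p j) (cyc i′ j′)     b≡ l≡ = ⊥-elim (c+c≢1+d+d (toℕ i′) (toℕ i) (sym l≡))
  code-injective (cyc i j)    (spoke j′)      b≡ l≡ = ⊥-elim (c+c≢1+d+d (toℕ i) m′ l≡)
  code-injective (spoke j)    (cyc i′ j′)     b≡ l≡ = ⊥-elim (c+c≢1+d+d (toℕ i′) m′ (sym l≡))
  code-injective (rung i p j) (spoke j′)      b≡ l≡ = ⊥-elim (<-irrefl (c+c≡d+d⇒c≡d (suc-injective l≡)) (≤-pred p))
  code-injective (spoke j)    (rung i′ p′ j′) b≡ l≡ = ⊥-elim (<-irrefl (c+c≡d+d⇒c≡d (suc-injective (sym l≡))) (≤-pred p′))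

  code-surjective : ∀ {b l} → b < n → l < suc K → ∃ λ e → proj₁ (code e) ≡ b × proj₂ (code e) ≡ l
  code-surjective {b} {l} b< l< with l ≟ K
  ... | yes refl = let t , t< , label-t = Label.surjective b< in
                   spoke (fromℕ< t<) , trans (cong label (Fin.toℕ-fromℕ< t<)) label-t , refl
  ... | no l≢K = level (parity l) (≤-pred (≤∧≢⇒< (≤-pred l<) l≢K))
    where
    layer : ∀ i → i < m → ∃ λ (i′ : Fin m) → ∃ λ j → toℕ i′ ≡ i × sum (diag i′ j) ≡ b
    layer i i<m with Sum.surjective b<
    ... | t , t< , sum-t with diag-surjective (fromℕ< i<m) t<
    ... | j , diag≡ = fromℕ< i<m , j , Fin.toℕ-fromℕ< i<m , trans (cong sum diag≡) sum-t
    level : ∀ {l} → Parity l → l ≤ m′ + m′ → ∃ λ e → proj₁ (code e) ≡ b × proj₂ (code e) ≡ l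
    level (even i) l≤ with layer i (s≤s (c+c≤1+d+d⇒c≤d (m≤n⇒m≤1+n l≤)))
    ... | i′ , j , refl , sum≡ = cyc i′ j , sum≡ , refl
    level (odd i) l≤ with layer i (m≤n⇒m≤1+n (1+c+c≤d+d⇒c<d l≤))
    ... | i′ , j , refl , sum≡ = rung i′ (s≤s (1+c+c≤d+d⇒c<d l≤)) j , sum≡ , refl

  f-injective : ∀ u v → f u ≈ f v → u ≡ v
  f-injective apex       apex         _  = refl
  f-injective apex       (cell i j)   eq =
    ⊥-elim (<-irrefl (sym (proj₂ (point-injective shift< ≤-refl (cell-label< i j) (i<1+K i) eq))) (i<K i))
  f-injective (cell i j) apex         eq =
    ⊥-elim (<-irrefl (proj₂ (point-injective (cell-label< i j) (i<1+K i) shift< ≤-refl eq)) (i<K i))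
  f-injective (cell i j) (cell i′ j′) eq
    with point-injective (cell-label< i j) (i<1+K i) (cell-label< i′ j′) (i<1+K i′) eq
  ... | label≡ , i≡ with Fin.toℕ-injective {i = i} {i′} i≡
  ... | refl = cong (cell i) (diag-injective i (Label.injective (diag< i j) (diag< i j′) label≡))

  weight-injective : ∀ e e′ → weight e ≈ weight e′ → e ≡ e′
  weight-injective e e′ eq with code-bounded e | code-bounded e′
  ... | b< , l< | b′< , l′<
    with point-injective b< l< b′< l′< (∙-cancelʳ C _ _ (≈-trans (≈-sym (weight-code e)) (≈-trans eq (weight-code e′))))
  ... | b≡ , l≡ = code-injective e e′ b≡ l≡

  weight-surjective : ∀ x → ∃ λ e → weight e ≈ x
  weight-surjective x with point-surjective (x ∙ C ⁻¹)
  ... | b , l , b< , l< , point≈ with code-surjective b< l<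
  ... | e , refl , refl = e , ≈-trans (weight-code e) (≈-trans (∙-cong point≈ ≈-refl) (//-rightDividesˡ C x))

  harmonious : CW-Harmonious G m n
  harmonious = f , f-injective , weight-injective , weight-surjective

2*[1+k]≡2+k+k : ∀ k → 2 * suc k ≡ suc (suc (k + k))
2*[1+k]≡2+k+k k = cong suc (trans (+-suc k (k + 0)) (cong (λ i → suc (k + i)) (+-identityʳ k)))

corollary8p5 : ∀ {c ℓ : Level} (m n : ℕ) → 3 ≤ n → n % 2 ≡ 1 → 2 ≤ m →
    (G : AbelianGroup c ℓ) → HasOrder G (2 * m * n) →
    HasCyclicSubgroupOfOrder G (2 * m) →
    CW-Harmonious G m n
corollary8p5 zero     n _ _     ()
corollary8p5 (suc m′) n _ n-odd _ G order cyclic =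
  from-coordinates (FiniteAbelianGroup.coordinates G order (subst (HasCyclicSubgroupOfOrder G) (2*[1+k]≡2+k+k m′) cyclic))
  where
  M : ℕ
  M = suc (suc (m′ + m′))
  from-coordinates : (∃ λ ks → capacity ks * M ≡ 2 * suc m′ * n × Expansion.Coordinates G ks M) → CW-Harmonious G (suc m′) n
  from-coordinates (ks , R*M≡N , coords) =
    subst (CW-Harmonious G (suc m′)) R≡n (Labelling.harmonious G m′ (harmoniousCycle ks R-odd) coords)
    where
    R≡n : capacity ks ≡ n
    R≡n = *-cancelʳ-≡ (capacity ks) n M (trans R*M≡N (trans (*-comm (2 * suc m′) n) (cong (n *_) (2*[1+k]≡2+k+k m′))))
    R-odd : Odd (capacity ks)
    R-odd = subst Odd (sym R≡n) (n%2≡1⇒Odd n n-odd)
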